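{- Let $G$ be a finite cyclic group and let $f$ be an automorphism of $\mathcal{P}_{0}(G)$ with trivial pullback. Then $f$ is the identity.
   Context: For an additively written finite abelian group $G$, $\mathcal{P}_{0}(G)$ denotes the reduced power monoid of $G$: the set of all subsets of $G$ containing $0$, with setwise addition $X+Y=\{x+y : x\in X, y\in Y\}$ and identity $\{0\}$. An automorphism $f$ of $\mathcal{P}_{0}(G)$ has trivial pullback if $f(\{0,a\})=\{0,a\}$ for every $a\in G$. -}

module Defs where

open import Data.Nat using (ℕ; suc)
open import Data.Nat.DivMod using (_mod_)
open import Data.Bool using (Bool; true; false; _∧_; _∨_)
open import Data.Fin using (Fin; zero; suc; toℕ)
open import Data.Fin.Properties using (_≟_)
open import Data.Fin.Subset using (Subset; _∈_; ⁅_⁆; _∪_)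
open import Data.Vec using (lookup; tabulate)
open import Relation.Nullary.Decidable using (⌊_⌋)
open import Relation.Binary.PropositionalEquality using (_≡_)
open import Data.Product using (Σ; _×_)

-- The cyclic group ℤ/(suc n)ℤ, carrier Fin (suc n), addition modulo suc n.
-- Every finite cyclic group is isomorphic to exactly one of these.
Cyc : ℕ → Set
Cyc n = Fin (suc n)

_+G_ : {n : ℕ} → Cyc n → Cyc n → Cyc n
_+G_ {n} a b = (toℕ a ℕ.+ toℕ b) mod (suc n)
  where import Data.Nat as ℕ

anyFin : {k : ℕ} → (Fin k → Bool) → Bool
anyFin {ℕ.zero} p = false
  where import Data.Nat as ℕ
anyFin {suc k} p = p zero ∨ anyFin (λ i → p (suc i))

_⊕_ : {n : ℕ} → Subset (suc n) → Subset (suc n) → Subset (suc n)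
X ⊕ Y = tabulate λ z →
  anyFin λ x → anyFin λ y → lookup X x ∧ lookup Y y ∧ ⌊ (x +G y) ≟ z ⌋

InP₀ : {n : ℕ} → Subset (suc n) → Set
InP₀ X = zero ∈ X

-- f (a map on all subsets) restricts to an automorphism of the monoid P₀(G):
-- maps P₀ into P₀, injective and surjective on P₀, preserves the
-- operation and the identity {0}.
IsAutP₀ : {n : ℕ} → (Subset (suc n) → Subset (suc n)) → Set
IsAutP₀ {n} f =
  ((X : Subset (suc n)) → InP₀ X → InP₀ (f X)) ×
  ((X Y : Subset (suc n)) → InP₀ X → InP₀ Y → f X ≡ f Y → X ≡ Y) ×
  ((Y : Subset (suc n)) → InP₀ Y → Σ (Subset (suc n)) λ X → InP₀ X × (f X ≡ Y)) ×
  ((X Y : Subset (suc n)) → InP₀ X → InP₀ Y → f (X ⊕ Y) ≡ f X ⊕ f Y) ×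
  (f ⁅ zero ⁆ ≡ ⁅ zero ⁆)

TrivialPullback : {n : ℕ} → (Subset (suc n) → Subset (suc n)) → Set
TrivialPullback {n} f = (a : Cyc n) → f (⁅ zero ⁆ ∪ ⁅ a ⁆) ≡ ⁅ zero ⁆ ∪ ⁅ a ⁆

module Submission where

-- An element a is a period of X when X + a = X.  If a is not a period, X + {0,a} strictly contains X, so
-- by induction on the complement of X we may assume f fixes it.  For V with f V = X this gives
-- f (V + {0,a}) = X + {0,a} = f (X + {0,a}), hence V + {0,a} = X + {0,a} for every non-period a,
-- and these equations force V = X unless the complement of X is a single coset z + H of the
-- period group H.  In that case X is a sum of sets {0,a}, which f fixes because it is a
-- homomorphism with trivial pullback: with [-l, k]·1 the longest run of multiples of the
-- generator 1 around 0 inside X, both (k+1)·1 and -(l+1)·1 lie in z + H, so D = k + l + 2 makes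
-- D·1 a period, and division by D gives X = {0, D·1, 2D·1, …} + {-l·1, …, k·1}.

open import Algebra.Bundles using (AbelianGroup)
open import Algebra.Structures using (IsAbelianGroup)
open import Data.Bool using (Bool; T; _∧_)
open import Data.Bool.Properties using (T-∧; T-∨; T-≡)
open import Data.Empty using (⊥)
open import Data.Fin using (Fin; toℕ)
open import Data.Fin.Properties using (toℕ-fromℕ<; toℕ-injective; toℕ<n; _≟_; all?; any?; ¬∀⟶∃¬)
open import Data.Fin.Subset using (Subset; _∈_; _∉_; ⁅_⁆; _∪_; _⊆_; _⊂_; _⊃_)
open import Data.Fin.Subset.Induction using (⊃-wellFounded)
open import Data.Fin.Subset.Properties using (x∈⁅x⁆; x∈⁅y⁆⇒x≡y; x∈p∪q⁻; x∈p∪q⁺; _∈?_; ⊆-antisym)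
open import Data.Nat as ℕ using (ℕ; zero; suc; _%_; _∸_; _*_; _≤_; z≤n; s≤s)
open import Data.Nat.DivMod
  using (_mod_; _/_; m%n<n; m<n⇒m%n≡m; n%n≡0; m%n%n≡m%n; m*n%n≡0; %-distribˡ-+; m≡m%n+[m/n]*n; m/n≤m)
import Data.Nat.Properties as ℕ
open import Data.Product using (_×_; _,_; ∃; ∃₂; proj₁; proj₂)
open import Data.Sum using (_⊎_; inj₁; inj₂)
open import Data.Vec using (lookup)
open import Data.Vec.Properties using ([]=⇒lookup; lookup⇒[]=; lookup∘tabulate)
open import Function.Base using (_∘_)
open import Function.Bundles using (module Equivalence)
open import Induction.WellFounded using (module All)
open import Level using (0ℓ)
open import Relation.Binary.Definitions using (Tri; tri<; tri≈; tri>)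
open import Relation.Binary.PropositionalEquality hiding (J)
open import Relation.Nullary.Decidable
  using (Dec; yes; no; ⌊_⌋; toWitness; fromWitness; _→-dec_; _×-dec_; ¬?; decidable-stable)
open import Relation.Nullary.Negation using (¬_; contradiction)
open import Relation.Unary using (Decidable)

open import Defs

module Cyclic (n : ℕ) where

  infix 35 -G_
  -G_ : Cyc n → Cyc n
  -G a = (suc n ∸ toℕ a) mod suc n

  private
    toℕ-mod : ∀ x → toℕ (x mod suc n) ≡ x % suc n
    toℕ-mod x = toℕ-fromℕ< (m%n<n x (suc n))

    %-absorbˡ : ∀ x y → (x % suc n ℕ.+ y) % suc n ≡ (x ℕ.+ y) % suc n
    %-absorbˡ x y = begin
      (x % suc n ℕ.+ y) % suc n                    ≡⟨ %-distribˡ-+ (x % suc n) y (suc n) ⟩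
      (x % suc n % suc n ℕ.+ y % suc n) % suc n    ≡⟨ cong (λ u → (u ℕ.+ y % suc n) % suc n) (m%n%n≡m%n x (suc n)) ⟩
      (x % suc n ℕ.+ y % suc n) % suc n            ≡⟨ %-distribˡ-+ x y (suc n) ⟨
      (x ℕ.+ y) % suc n                            ∎
      where open ≡-Reasoning

    mod-absorbˡ : ∀ x y → (toℕ (x mod suc n) ℕ.+ y) mod suc n ≡ (x ℕ.+ y) mod suc n
    mod-absorbˡ x y = toℕ-injective (begin
      toℕ ((toℕ (x mod suc n) ℕ.+ y) mod suc n) ≡⟨ toℕ-mod (toℕ (x mod suc n) ℕ.+ y) ⟩
      (toℕ (x mod suc n) ℕ.+ y) % suc n         ≡⟨ cong (λ u → (u ℕ.+ y) % suc n) (toℕ-mod x) ⟩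
      (x % suc n ℕ.+ y) % suc n                 ≡⟨ %-absorbˡ x y ⟩
      (x ℕ.+ y) % suc n                         ≡⟨ toℕ-mod (x ℕ.+ y) ⟨
      toℕ ((x ℕ.+ y) mod suc n)                 ∎)
      where open ≡-Reasoning

    mod-absorbʳ : ∀ x y → (x ℕ.+ toℕ (y mod suc n)) mod suc n ≡ (x ℕ.+ y) mod suc n
    mod-absorbʳ x y = begin
      (x ℕ.+ toℕ (y mod suc n)) mod suc n ≡⟨ cong (_mod suc n) (ℕ.+-comm x _) ⟩
      (toℕ (y mod suc n) ℕ.+ x) mod suc n ≡⟨ mod-absorbˡ y x ⟩
      (y ℕ.+ x) mod suc n                 ≡⟨ cong (_mod suc n) (ℕ.+-comm y x) ⟩
      (x ℕ.+ y) mod suc n                 ∎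
      where open ≡-Reasoning

  mod-toℕ : ∀ (a : Cyc n) → toℕ a mod suc n ≡ a
  mod-toℕ a = toℕ-injective (trans (toℕ-mod (toℕ a)) (m<n⇒m%n≡m (toℕ<n a)))

  +G-comm : ∀ a b → a +G b ≡ b +G a
  +G-comm a b = cong (_mod suc n) (ℕ.+-comm (toℕ a) (toℕ b))

  +G-assoc : ∀ a b c → (a +G b) +G c ≡ a +G (b +G c)
  +G-assoc a b c = begin
    (toℕ (a +G b) ℕ.+ toℕ c) mod suc n        ≡⟨ mod-absorbˡ (toℕ a ℕ.+ toℕ b) (toℕ c) ⟩
    (toℕ a ℕ.+ toℕ b ℕ.+ toℕ c) mod suc n     ≡⟨ cong (_mod suc n) (ℕ.+-assoc (toℕ a) (toℕ b) (toℕ c)) ⟩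
    (toℕ a ℕ.+ (toℕ b ℕ.+ toℕ c)) mod suc n   ≡⟨ mod-absorbʳ (toℕ a) (toℕ b ℕ.+ toℕ c) ⟨
    (toℕ a ℕ.+ toℕ (b +G c)) mod suc n        ∎
    where open ≡-Reasoning

  +G-identityˡ : ∀ a → Fin.zero +G a ≡ a
  +G-identityˡ = mod-toℕ

  +G-inverseʳ : ∀ a → a +G -G a ≡ Fin.zero
  +G-inverseʳ a = begin
    (toℕ a ℕ.+ toℕ (-G a)) mod suc n       ≡⟨ mod-absorbʳ (toℕ a) (suc n ∸ toℕ a) ⟩
    (toℕ a ℕ.+ (suc n ∸ toℕ a)) mod suc n  ≡⟨ cong (_mod suc n) (ℕ.m+[n∸m]≡n (ℕ.<⇒≤ (toℕ<n a))) ⟩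
    suc n mod suc n                        ≡⟨ toℕ-injective (trans (toℕ-mod (suc n)) (n%n≡0 (suc n))) ⟩
    Fin.zero                               ∎
    where open ≡-Reasoning

  +G-identityʳ : ∀ a → a +G Fin.zero ≡ a
  +G-identityʳ a = trans (+G-comm a Fin.zero) (+G-identityˡ a)

  +G-isAbelianGroup : IsAbelianGroup _≡_ _+G_ Fin.zero -G_
  +G-isAbelianGroup = record
    { isGroup = record
      { isMonoid = record
        { isSemigroup = record
          { isMagma = record { isEquivalence = isEquivalence ; ∙-cong = cong₂ _+G_ }
          ; assoc = +G-assoc
          }
        ; identity = +G-identityˡ , +G-identityʳ
        }
      ; inverse = (λ a → trans (+G-comm (-G a) a) (+G-inverseʳ a)) , +G-inverseʳ
      ; ⁻¹-cong = cong -G_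
      }
    ; comm = +G-comm
    }

  +G-abelianGroup : AbelianGroup 0ℓ 0ℓ
  +G-abelianGroup = record { isAbelianGroup = +G-isAbelianGroup }

  open import Algebra.Properties.AbelianGroup +G-abelianGroup public
    using (inverseʳ-unique; ε⁻¹≈ε; ⁻¹-∙-comm; ⁻¹-involutive; ⁻¹-anti-homo‿-; xyx⁻¹≈y;
           \\-leftDividesʳ; //-rightDividesˡ; //-rightDividesʳ; ∙-cancelʳ)
  open import Algebra.Properties.CommutativeSemigroup (AbelianGroup.commutativeSemigroup +G-abelianGroup)
    public using (interchange; xy∙z≈xz∙y)
  open import Algebra.Properties.CommutativeMonoid.Mult (AbelianGroup.commutativeMonoid +G-abelianGroup)
    public using (×-homo-+; ×-assocˡ) renaming (_×_ to infixr 30 _·_)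

  one : Cyc n
  one = 1 mod suc n

  ·one≡mod : ∀ j → j · one ≡ j mod suc n
  ·one≡mod zero    = refl
  ·one≡mod (suc j) = toℕ-injective (begin
    toℕ (one +G j · one)                  ≡⟨ toℕ-mod (toℕ one ℕ.+ toℕ (j · one)) ⟩
    (toℕ one ℕ.+ toℕ (j · one)) % suc n   ≡⟨ cong₂ (λ u v → (u ℕ.+ v) % suc n) (toℕ-mod 1) (cong toℕ (·one≡mod j)) ⟩
    (1 % suc n ℕ.+ toℕ (j mod suc n)) % suc n ≡⟨ cong (λ v → (1 % suc n ℕ.+ v) % suc n) (toℕ-mod j) ⟩
    (1 % suc n ℕ.+ j % suc n) % suc n     ≡⟨ %-distribˡ-+ 1 j (suc n) ⟨
    suc j % suc n                         ≡⟨ toℕ-mod (suc j) ⟨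
    toℕ (suc j mod suc n)                 ∎)
    where open ≡-Reasoning

  one-generates : ∀ g → toℕ g · one ≡ g
  one-generates g = trans (·one≡mod (toℕ g)) (mod-toℕ g)

  [1+n]·x≡0 : ∀ x → suc n · x ≡ Fin.zero
  [1+n]·x≡0 x = begin
    suc n · x                       ≡⟨ cong (suc n ·_) (one-generates x) ⟨
    suc n · toℕ x · one             ≡⟨ ×-assocˡ one (suc n) (toℕ x) ⟩
    (suc n * toℕ x) · one           ≡⟨ ·one≡mod (suc n * toℕ x) ⟩
    (suc n * toℕ x) mod suc n       ≡⟨ toℕ-injective toℕ[[1+n]*x]≡0 ⟩
    Fin.zero                        ∎
    where
    open ≡-Reasoning
    toℕ[[1+n]*x]≡0 : toℕ ((suc n * toℕ x) mod suc n) ≡ 0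
    toℕ[[1+n]*x]≡0 = trans (toℕ-mod (suc n * toℕ x))
      (trans (cong (_% suc n) (ℕ.*-comm (suc n) (toℕ x))) (m*n%n≡0 (toℕ x) (suc n)))

  n·x≡-x : ∀ x → n · x ≡ -G x
  n·x≡-x x = inverseʳ-unique x (n · x) ([1+n]·x≡0 x)

  ·-⁻¹-comm : ∀ p x → p · -G x ≡ -G (p · x)
  ·-⁻¹-comm zero    x = sym ε⁻¹≈ε
  ·-⁻¹-comm (suc p) x = trans (cong (-G x +G_) (·-⁻¹-comm p x)) (⁻¹-∙-comm x (p · x))

  -one-generates : ∀ g → toℕ (-G g) · -G one ≡ g
  -one-generates g =
    trans (·-⁻¹-comm (toℕ (-G g)) one) (trans (cong -G_ (one-generates (-G g))) (⁻¹-involutive g))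

  ·-difference : ∀ p q x → p · x +G q · -G x ≡ (p ∸ q) · x +G (q ∸ p) · -G x
  ·-difference zero    zero    x = refl
  ·-difference zero    (suc q) x = refl
  ·-difference (suc p) zero    x = refl
  ·-difference (suc p) (suc q) x = begin
    (x +G p · x) +G (-G x +G q · -G x)   ≡⟨ interchange x (p · x) (-G x) (q · -G x) ⟩
    (x +G -G x) +G (p · x +G q · -G x)   ≡⟨ cong (_+G (p · x +G q · -G x)) (+G-inverseʳ x) ⟩
    Fin.zero +G (p · x +G q · -G x)      ≡⟨ +G-identityˡ _ ⟩
    p · x +G q · -G x                    ≡⟨ ·-difference p q x ⟩
    (p ∸ q) · x +G (q ∸ p) · -G x        ∎
    where open ≡-Reasoning

  x+[z-w]≡z⇒x≡w : ∀ x z w → x +G (z +G -G w) ≡ z → x ≡ w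
  x+[z-w]≡z⇒x≡w x z w eq =
    ∙-cancelʳ (z +G -G w) x w (trans eq (sym (trans (+G-comm w _) (//-rightDividesˡ w z))))

  x-[x-y]≡y : ∀ x y → x +G -G (x +G -G y) ≡ y
  x-[x-y]≡y x y = begin
    x +G -G (x +G -G y)  ≡⟨ cong (x +G_) (⁻¹-anti-homo‿- x y) ⟩
    x +G (y +G -G x)     ≡⟨ +G-assoc x y (-G x) ⟨
    (x +G y) +G -G x     ≡⟨ xyx⁻¹≈y x y ⟩
    y                    ∎
    where open ≡-Reasoning

  [z-x]⁻¹+[z-y]≡x-y : ∀ z x y → -G (z +G -G x) +G (z +G -G y) ≡ x +G -G y
  [z-x]⁻¹+[z-y]≡x-y z x y = begin
    -G (z +G -G x) +G (z +G -G y)  ≡⟨ cong (_+G (z +G -G y)) (⁻¹-anti-homo‿- z x) ⟩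
    (x +G -G z) +G (z +G -G y)     ≡⟨ +G-assoc x (-G z) _ ⟩
    x +G (-G z +G (z +G -G y))     ≡⟨ cong (x +G_) (\\-leftDividesʳ z (-G y)) ⟩
    x +G -G y                      ∎
    where open ≡-Reasoning


first-failure : {P : ℕ → Set} → Decidable P → P 0 → ∀ {N} → ¬ P N →
                ∃ λ k → (∀ {j} → j ≤ k → P j) × ¬ P (suc k)
first-failure {P} P? P0 {N} ¬PN =
  climb 0 (λ { z≤n → P0 }) N (subst (¬_ ∘ P) (sym (ℕ.+-identityʳ N)) ¬PN)
  where
  climb : ∀ k → (∀ {j} → j ≤ k → P j) → ∀ d → ¬ P (d ℕ.+ k) →
          ∃ λ k → (∀ {j} → j ≤ k → P j) × ¬ P (suc k)
  climb k below zero    ¬P = contradiction (below ℕ.≤-refl) ¬P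
  climb k below (suc d) ¬P with P? (suc k)
  ... | no ¬P[1+k] = k , below , ¬P[1+k]
  ... | yes P[1+k] = climb (suc k) below′ d (subst (¬_ ∘ P) (sym (ℕ.+-suc d k)) ¬P)
    where
    below′ : ∀ {j} → j ≤ suc k → P j
    below′ j≤1+k with ℕ.m≤n⇒m<n∨m≡n j≤1+k
    ... | inj₁ j<1+k = below (ℕ.≤-pred j<1+k)
    ... | inj₂ refl  = P[1+k]

anyFin⁺ : ∀ {k} (p : Fin k → Bool) i → T (p i) → T (anyFin p)
anyFin⁺ p Fin.zero    t = Equivalence.from T-∨ (inj₁ t)
anyFin⁺ p (Fin.suc i) t = Equivalence.from T-∨ (inj₂ (anyFin⁺ (λ j → p (Fin.suc j)) i t))

anyFin⁻ : ∀ {k} (p : Fin k → Bool) → T (anyFin p) → ∃ λ i → T (p i)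
anyFin⁻ {suc k} p t with Equivalence.to T-∨ t
... | inj₁ t₀ = Fin.zero , t₀
... | inj₂ t₁ with anyFin⁻ (λ j → p (Fin.suc j)) t₁
...   | i , tᵢ = Fin.suc i , tᵢ

module PowerMonoid (n : ℕ) where

  open Cyclic n

  private
    Sub : Set
    Sub = Subset (suc n)

    ∈⇒T : ∀ {x} {X : Sub} → x ∈ X → T (lookup X x)
    ∈⇒T x∈X = Equivalence.from T-≡ ([]=⇒lookup x∈X)

    T⇒∈ : ∀ {x} {X : Sub} → T (lookup X x) → x ∈ X
    T⇒∈ {x} {X} t = lookup⇒[]= x X (Equivalence.to T-≡ t)

    witnesses : Sub → Sub → Cyc n → Cyc n → Cyc n → Bool
    witnesses X Y z x y = lookup X x ∧ lookup Y y ∧ ⌊ x +G y ≟ z ⌋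

    lookup-⊕ : ∀ X Y z → lookup (X ⊕ Y) z ≡ anyFin (λ x → anyFin (witnesses X Y z x))
    lookup-⊕ X Y = lookup∘tabulate (λ z → anyFin (λ x → anyFin (witnesses X Y z x)))

  ∈⊕⁺ : ∀ {X Y : Sub} {x y} → x ∈ X → y ∈ Y → x +G y ∈ X ⊕ Y
  ∈⊕⁺ {X} {Y} {x} {y} x∈X y∈Y = T⇒∈ (subst T (sym (lookup-⊕ X Y (x +G y)))
    (anyFin⁺ (λ u → anyFin (witnesses X Y (x +G y) u)) x (anyFin⁺ (witnesses X Y (x +G y) x) y
      (Equivalence.from T-∧ (∈⇒T x∈X , Equivalence.from T-∧ (∈⇒T y∈Y , fromWitness refl))))))

  ∈⊕⁻ : ∀ {X Y : Sub} {z} → z ∈ X ⊕ Y → ∃₂ λ x y → x ∈ X × y ∈ Y × x +G y ≡ z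
  ∈⊕⁻ {X} {Y} {z} z∈X⊕Y
    with x , tx ← anyFin⁻ _ (subst T (lookup-⊕ X Y z) (∈⇒T z∈X⊕Y))
    with y , txy ← anyFin⁻ (witnesses X Y z x) tx
    with tX , tYz ← Equivalence.to T-∧ txy
    with tY , tz ← Equivalence.to T-∧ tYz
    = x , y , T⇒∈ tX , T⇒∈ tY , toWitness tz

  ⊕-least : ∀ {X Y Z : Sub} → (∀ {x y} → x ∈ X → y ∈ Y → x +G y ∈ Z) → X ⊕ Y ⊆ Z
  ⊕-least {X} {Y} {Z} sums∈Z z∈X⊕Y = sum∈Z (∈⊕⁻ {X} {Y} z∈X⊕Y)
    where
    sum∈Z : ∀ {z} → (∃₂ λ x y → x ∈ X × y ∈ Y × x +G y ≡ z) → z ∈ Z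
    sum∈Z (x , y , x∈X , y∈Y , x+y≡z) = subst (_∈ Z) x+y≡z (sums∈Z x∈X y∈Y)

  ⁅0,_⁆ : Cyc n → Sub
  ⁅0, a ⁆ = ⁅ Fin.zero ⁆ ∪ ⁅ a ⁆

  0∈⁅0,a⁆ : ∀ a → Fin.zero ∈ ⁅0, a ⁆
  0∈⁅0,a⁆ a = x∈p∪q⁺ (inj₁ (x∈⁅x⁆ Fin.zero))

  a∈⁅0,a⁆ : ∀ a → a ∈ ⁅0, a ⁆
  a∈⁅0,a⁆ a = x∈p∪q⁺ (inj₂ (x∈⁅x⁆ a))

  ∈⁅0,a⁆⁻ : ∀ {a y} → y ∈ ⁅0, a ⁆ → y ≡ Fin.zero ⊎ y ≡ a
  ∈⁅0,a⁆⁻ {a} y∈ with x∈p∪q⁻ ⁅ Fin.zero ⁆ ⁅ a ⁆ y∈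
  ... | inj₁ y∈0 = inj₁ (x∈⁅y⁆⇒x≡y Fin.zero y∈0)
  ... | inj₂ y∈a = inj₂ (x∈⁅y⁆⇒x≡y a y∈a)

  0∈⊕ : ∀ {X Y : Sub} → Fin.zero ∈ X → Fin.zero ∈ Y → Fin.zero ∈ X ⊕ Y
  0∈⊕ {X} {Y} 0∈X 0∈Y = subst (_∈ X ⊕ Y) (+G-identityˡ Fin.zero) (∈⊕⁺ 0∈X 0∈Y)

  ⊆⊕⁅0,a⁆ : ∀ {X} a → X ⊆ X ⊕ ⁅0, a ⁆
  ⊆⊕⁅0,a⁆ {X} a {x} x∈X = subst (_∈ X ⊕ ⁅0, a ⁆) (+G-identityʳ x) (∈⊕⁺ x∈X (0∈⁅0,a⁆ a))

  ∈⊕⁅0,a⁆⁻ : ∀ {X a z} → z ∈ X ⊕ ⁅0, a ⁆ → z ∈ X ⊎ ∃ λ x → x ∈ X × x +G a ≡ z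
  ∈⊕⁅0,a⁆⁻ {X} {a} {z} z∈ = sort (∈⊕⁻ z∈)
    where
    sort : (∃₂ λ x y → x ∈ X × y ∈ ⁅0, a ⁆ × x +G y ≡ z) → z ∈ X ⊎ ∃ λ x → x ∈ X × x +G a ≡ z
    sort (x , y , x∈X , y∈ , x+y≡z) with ∈⁅0,a⁆⁻ y∈
    ... | inj₁ y≡0 = inj₁ (subst (_∈ X) (trans (sym (+G-identityʳ x)) (trans (cong (x +G_) (sym y≡0)) x+y≡z)) x∈X)
    ... | inj₂ y≡a = inj₂ (x , x∈X , trans (cong (x +G_) (sym y≡a)) x+y≡z)

  data PairSum : Sub → Set where
    ε    : PairSum ⁅ Fin.zero ⁆
    pair : ∀ a → PairSum ⁅0, a ⁆
    _⊕ₚ_ : ∀ {X Y} → PairSum X → PairSum Y → PairSum (X ⊕ Y)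

  0∈PairSum : ∀ {X} → PairSum X → Fin.zero ∈ X
  0∈PairSum ε         = x∈⁅x⁆ Fin.zero
  0∈PairSum (pair a)  = 0∈⁅0,a⁆ a
  0∈PairSum (p ⊕ₚ q)  = 0∈⊕ (0∈PairSum p) (0∈PairSum q)

  multiples : ℕ → Cyc n → Sub
  multiples zero    a = ⁅ Fin.zero ⁆
  multiples (suc k) a = multiples k a ⊕ ⁅0, a ⁆

  multiples-pairSum : ∀ k a → PairSum (multiples k a)
  multiples-pairSum zero    a = ε
  multiples-pairSum (suc k) a = multiples-pairSum k a ⊕ₚ pair a

  ·∈multiples : ∀ {j k} a → j ≤ k → j · a ∈ multiples k a
  ·∈multiples {k = k} a z≤n = 0∈PairSum (multiples-pairSum k a)
  ·∈multiples {suc j} {suc k} a (s≤s j≤k) =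
    subst (_∈ multiples (suc k) a) (+G-comm (j · a) a) (∈⊕⁺ (·∈multiples a j≤k) (a∈⁅0,a⁆ a))

  ∈multiples⁻ : ∀ k a {g} → g ∈ multiples k a → ∃ λ j → j ≤ k × j · a ≡ g
  ∈multiples⁻ zero    a g∈ = 0 , z≤n , sym (x∈⁅y⁆⇒x≡y Fin.zero g∈)
  ∈multiples⁻ (suc k) a {g} g∈ = sort (∈⊕⁅0,a⁆⁻ {multiples k a} {a} g∈)
    where
    sort : g ∈ multiples k a ⊎ (∃ λ x → x ∈ multiples k a × x +G a ≡ g) → ∃ λ j → j ≤ suc k × j · a ≡ g
    sort (inj₁ g∈multiples) with j , j≤k , j·a≡g ← ∈multiples⁻ k a g∈multiples =
      j , ℕ.m≤n⇒m≤1+n j≤k , j·a≡g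
    sort (inj₂ (x , x∈multiples , x+a≡g)) with j , j≤k , j·a≡x ← ∈multiples⁻ k a x∈multiples =
      suc j , s≤s j≤k , trans (+G-comm a (j · a)) (trans (cong (_+G a) j·a≡x) x+a≡g)

  -- X + a ⊆ X, which for finite X already means X + a = X.
  Period : Sub → Cyc n → Set
  Period X a = ∀ x → x ∈ X → x +G a ∈ X

  period? : ∀ X a → Dec (Period X a)
  period? X a = all? (λ x → x ∈? X →-dec x +G a ∈? X)

  period-+ : ∀ {X a b} → Period X a → Period X b → Period X (a +G b)
  period-+ {X} {a} {b} pa pb x x∈X = subst (_∈ X) (+G-assoc x a b) (pb (x +G a) (pa x x∈X))

  period-· : ∀ {X a} j → Period X a → Period X (j · a)
  period-· {X} zero    pa x x∈X = subst (_∈ X) (sym (+G-identityʳ x)) x∈X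
  period-·     (suc j) pa       = period-+ pa (period-· j pa)

  period-⁻¹ : ∀ {X a} → Period X a → Period X (-G a)
  period-⁻¹ {X} {a} pa = subst (Period X) (n·x≡-x a) (period-· n pa)

  CosetComplement : Sub → Set
  CosetComplement X = ∃ λ z → z ∉ X × (∀ w → w ∉ X → Period X (z +G -G w))

  Scattered : Sub → Set
  Scattered X = ∀ z → z ∉ X → ∃ λ w → w ∉ X × ¬ Period X (z +G -G w)

  module IntervalDecomposition {X z} (coset : ∀ w → w ∉ X → Period X (z +G -G w))
    {k} (below-k : ∀ {j} → j ≤ k → j · one ∈ X) (above-k : suc k · one ∉ X)
    {l} (below-l : ∀ {j} → j ≤ l → j · -G one ∈ X) (above-l : suc l · -G one ∉ X) where

    D : ℕ
    D = suc k ℕ.+ suc l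

    D-period : Period X (D · one)
    D-period = subst (Period X) c₁-c₂≡D (period-+ (period-⁻¹ (coset c₁ above-k)) (coset c₂ above-l))
      where
      c₁ c₂ : Cyc n
      c₁ = suc k · one
      c₂ = suc l · -G one
      c₁-c₂≡D : -G (z +G -G c₁) +G (z +G -G c₂) ≡ D · one
      c₁-c₂≡D = begin
        -G (z +G -G c₁) +G (z +G -G c₂)   ≡⟨ [z-x]⁻¹+[z-y]≡x-y z c₁ c₂ ⟩
        c₁ +G -G c₂                       ≡⟨ cong (λ u → c₁ +G -G u) (·-⁻¹-comm (suc l) one) ⟩
        c₁ +G -G -G (suc l · one)         ≡⟨ cong (c₁ +G_) (⁻¹-involutive (suc l · one)) ⟩
        c₁ +G suc l · one                 ≡⟨ ×-homo-+ one (suc k) (suc l) ⟨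
        D · one                           ∎
        where open ≡-Reasoning

    S J : Sub
    S = multiples (suc n) (D · one)
    J = multiples k one ⊕ multiples l (-G one)

    interval⊆X : ∀ {p q} → p ≤ k → q ≤ l → (p ∸ q) · one +G (q ∸ p) · -G one ∈ X
    interval⊆X {p} {q} p≤k q≤l with ℕ.≤-total q p
    ... | inj₁ q≤p rewrite ℕ.m≤n⇒m∸n≡0 q≤p =
      subst (_∈ X) (sym (+G-identityʳ _)) (below-k (ℕ.≤-trans (ℕ.m∸n≤m p q) p≤k))
    ... | inj₂ p≤q rewrite ℕ.m≤n⇒m∸n≡0 p≤q =
      subst (_∈ X) (sym (+G-identityˡ _)) (below-l (ℕ.≤-trans (ℕ.m∸n≤m q p) q≤l))

    J⊆X : J ⊆ X
    J⊆X = ⊕-least {multiples k one} {multiples l (-G one)} λ u∈ v∈ →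
      combine (∈multiples⁻ k one u∈) (∈multiples⁻ l (-G one) v∈)
      where
      combine : ∀ {u v} → (∃ λ p → p ≤ k × p · one ≡ u) → (∃ λ q → q ≤ l × q · -G one ≡ v) → u +G v ∈ X
      combine (p , p≤k , p·1≡u) (q , q≤l , q·-1≡v) =
        subst (_∈ X) (trans (sym (·-difference p q one)) (cong₂ _+G_ p·1≡u q·-1≡v)) (interval⊆X p≤k q≤l)

    S⊕J⊆X : S ⊕ J ⊆ X
    S⊕J⊆X = ⊕-least {S} {J} λ s∈S j∈J → translate (∈multiples⁻ (suc n) (D · one) s∈S) (J⊆X j∈J)
      where
      translate : ∀ {s j} → (∃ λ i → i ≤ suc n × i · D · one ≡ s) → j ∈ X → s +G j ∈ X
      translate {s} {j} (i , _ , i·D≡s) j∈X =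
        subst (_∈ X) (trans (+G-comm j (i · D · one)) (cong (_+G j) i·D≡s)) (period-· i D-period j j∈X)

    division : ∀ g → g ≡ (toℕ g % D) · one +G (toℕ g / D) · D · one
    division g = begin
      g                              ≡⟨ one-generates g ⟨
      toℕ g · one                    ≡⟨ cong (_· one) (m≡m%n+[m/n]*n (toℕ g) D) ⟩
      (r ℕ.+ q * D) · one            ≡⟨ ×-homo-+ one r (q * D) ⟩
      r · one +G (q * D) · one       ≡⟨ cong (r · one +G_) (×-assocˡ one q D) ⟨
      r · one +G q · D · one         ∎
      where
      open ≡-Reasoning
      r q : ℕ
      r = toℕ g % D
      q = toℕ g / D

    X⊆S⊕J : X ⊆ S ⊕ J
    X⊆S⊕J {g} g∈X = by-remainder (ℕ.<-cmp r (suc k))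
      where
      r q : ℕ
      r = toℕ g % D
      q = toℕ g / D
      q≤n : q ≤ n
      q≤n = ℕ.≤-trans (m/n≤m (toℕ g) D) (ℕ.≤-pred (toℕ<n g))
      g≡ : g ≡ r · one +G q · D · one
      g≡ = division g
      open ≡-Reasoning
      by-remainder : Tri (r ℕ.< suc k) (r ≡ suc k) (r ℕ.> suc k) → g ∈ S ⊕ J
      by-remainder (tri< r<1+k _ _) = subst (_∈ S ⊕ J) eq
        (∈⊕⁺ (·∈multiples (D · one) (ℕ.m≤n⇒m≤1+n q≤n))
             (∈⊕⁺ (·∈multiples one (ℕ.≤-pred r<1+k)) (·∈multiples (-G one) (z≤n {l}))))
        where
        eq : q · D · one +G (r · one +G Fin.zero) ≡ g
        eq = begin
          q · D · one +G (r · one +G Fin.zero)  ≡⟨ cong (q · D · one +G_) (+G-identityʳ (r · one)) ⟩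
          q · D · one +G r · one                ≡⟨ +G-comm (q · D · one) (r · one) ⟩
          r · one +G q · D · one                ≡⟨ g≡ ⟨
          g                                     ∎
      by-remainder (tri≈ _ r≡1+k _) = contradiction (subst (_∈ X) eq (period-⁻¹ (period-· q D-period) g g∈X)) above-k
        where
        eq : g +G -G (q · D · one) ≡ suc k · one
        eq = begin
          g +G -G (q · D · one)                           ≡⟨ cong (_+G -G (q · D · one)) g≡ ⟩
          (r · one +G q · D · one) +G -G (q · D · one)    ≡⟨ //-rightDividesʳ (q · D · one) (r · one) ⟩
          r · one                                         ≡⟨ cong (_· one) r≡1+k ⟩
          suc k · one                                     ∎
      by-remainder (tri> _ _ 1+k<r) = subst (_∈ S ⊕ J) eq
        (∈⊕⁺ (·∈multiples (D · one) (s≤s q≤n))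
             (∈⊕⁺ (·∈multiples one (z≤n {k})) (·∈multiples (-G one) e≤l)))
        where
        e : ℕ
        e = D ∸ r
        e≤l : e ≤ l
        e≤l = ℕ.≤-trans (ℕ.∸-monoʳ-≤ D 1+k<r)
                (ℕ.≤-reflexive (trans (cong (_∸ suc (suc k)) (ℕ.+-suc (suc k) l)) (ℕ.m+n∸m≡n (suc (suc k)) l)))
        g+e≡ : g +G e · one ≡ suc q · D · one
        g+e≡ = begin
          g +G e · one                          ≡⟨ cong (_+G e · one) g≡ ⟩
          (r · one +G q · D · one) +G e · one   ≡⟨ xy∙z≈xz∙y (r · one) (q · D · one) (e · one) ⟩
          (r · one +G e · one) +G q · D · one   ≡⟨ cong (_+G q · D · one) (×-homo-+ one r e) ⟨
          (r ℕ.+ e) · one +G q · D · one        ≡⟨ cong (λ u → u · one +G q · D · one) (ℕ.m+[n∸m]≡n (ℕ.<⇒≤ (m%n<n (toℕ g) D))) ⟩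
          D · one +G q · D · one                ∎
        eq : suc q · D · one +G (Fin.zero +G e · -G one) ≡ g
        eq = begin
          suc q · D · one +G (Fin.zero +G e · -G one)  ≡⟨ cong (suc q · D · one +G_) (trans (+G-identityˡ _) (·-⁻¹-comm e one)) ⟩
          suc q · D · one +G -G (e · one)              ≡⟨ cong (_+G -G (e · one)) g+e≡ ⟨
          (g +G e · one) +G -G (e · one)               ≡⟨ //-rightDividesʳ (e · one) g ⟩
          g                                            ∎

    pairSum : PairSum X
    pairSum = subst PairSum (⊆-antisym S⊕J⊆X X⊆S⊕J)
      (multiples-pairSum (suc n) (D · one) ⊕ₚ (multiples-pairSum k one ⊕ₚ multiples-pairSum l (-G one)))

  cosetComplement⇒pairSum : ∀ {X} → Fin.zero ∈ X → CosetComplement X → PairSum X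
  cosetComplement⇒pairSum {X} 0∈X (z , z∉X , coset)
    with k , below-k , above-k ← first-failure (λ j → j · one ∈? X) 0∈X {toℕ z}
                                   (z∉X ∘ subst (_∈ X) (one-generates z))
    with l , below-l , above-l ← first-failure (λ j → j · -G one ∈? X) 0∈X {toℕ (-G z)}
                                   (z∉X ∘ subst (_∈ X) (-one-generates z))
    = IntervalDecomposition.pairSum {X} {z} coset below-k above-k below-l above-l

  full⇒pairSum : ∀ {X} → (∀ g → g ∈ X) → PairSum X
  full⇒pairSum {X} full = subst PairSum (⊆-antisym (λ {g} _ → full g) X⊆multiples) (multiples-pairSum n one)
    where
    X⊆multiples : X ⊆ multiples n one
    X⊆multiples {g} _ = subst (_∈ multiples n one) (one-generates g) (·∈multiples one (ℕ.≤-pred (toℕ<n g)))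

  ¬period⇒⊂ : ∀ {X a} → ¬ Period X a → X ⊂ X ⊕ ⁅0, a ⁆
  ¬period⇒⊂ {X} {a} ¬pa with x , ¬[x∈X⇒x+a∈X] ← ¬∀⟶∃¬ (suc n) _ (λ x → x ∈? X →-dec x +G a ∈? X) ¬pa =
    ⊆⊕⁅0,a⁆ a , x +G a , ∈⊕⁺ x∈X (a∈⁅0,a⁆ a) , λ x+a∈X → ¬[x∈X⇒x+a∈X] (λ _ → x+a∈X)
    where
    x∈X : x ∈ X
    x∈X = decidable-stable (x ∈? X) (λ x∉X → ¬[x∈X⇒x+a∈X] (λ x∈X → contradiction x∈X x∉X))

  cosetComplement-or-scattered : ∀ X → CosetComplement X ⊎ Scattered X
  cosetComplement-or-scattered X
    with any? (λ z → ¬? (z ∈? X) ×-dec all? (λ w → ¬? (w ∈? X) →-dec period? X (z +G -G w)))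
  ... | yes coset = inj₁ coset
  ... | no ¬coset = inj₂ scattered
    where
    scattered : Scattered X
    scattered z z∉X
      with w , ¬[w∉X⇒period] ← ¬∀⟶∃¬ (suc n) _ (λ w → ¬? (w ∈? X) →-dec period? X (z +G -G w))
                                  (λ coset → ¬coset (z , z∉X , coset)) =
      w , (λ w∈X → ¬[w∉X⇒period] (λ w∉X → contradiction w∈X w∉X)) , (λ p → ¬[w∉X⇒period] (λ _ → p))

  ∉⊕⁅0,z-w⁆ : ∀ {Y z w} → z ∉ Y → w ∉ Y → z ∉ Y ⊕ ⁅0, z +G -G w ⁆
  ∉⊕⁅0,z-w⁆ {Y} {z} {w} z∉Y w∉Y z∈ = impossible (∈⊕⁅0,a⁆⁻ {Y} {z +G -G w} z∈)
    where
    impossible : z ∈ Y ⊎ (∃ λ y → y ∈ Y × y +G (z +G -G w) ≡ z) → ⊥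
    impossible (inj₁ z∈Y)                    = z∉Y z∈Y
    impossible (inj₂ (y , y∈Y , y+[z-w]≡z)) = w∉Y (subst (_∈ Y) (x+[z-w]≡z⇒x≡w y z w y+[z-w]≡z) y∈Y)

  ⊕⁅0,a⁆-cancel : ∀ {V X c} → c ∉ X → Scattered X →
                  (∀ a → ¬ Period X a → V ⊕ ⁅0, a ⁆ ≡ X ⊕ ⁅0, a ⁆) → V ≡ X
  ⊕⁅0,a⁆-cancel {V} {X} {c} c∉X scattered agree = ⊆-antisym V⊆X X⊆V
    where
    V⊆X : V ⊆ X
    V⊆X {z} z∈V = decidable-stable (z ∈? X) λ z∉X →
      let w , w∉X , ¬pa = scattered z z∉X in
      ∉⊕⁅0,z-w⁆ {X} z∉X w∉X (subst (z ∈_) (agree (z +G -G w) ¬pa) (⊆⊕⁅0,a⁆ {V} (z +G -G w) z∈V))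

    X⊆V : X ⊆ V
    X⊆V {x} x∈X = decidable-stable (x ∈? V) λ x∉V →
      ∉⊕⁅0,z-w⁆ {V} x∉V (c∉X ∘ V⊆X)
        (subst (x ∈_) (sym (agree (x +G -G c) ¬pa)) (⊆⊕⁅0,a⁆ {X} (x +G -G c) x∈X))
      where
      ¬pa : ¬ Period X (x +G -G c)
      ¬pa pa = c∉X (subst (_∈ X) (x-[x-y]≡y x c) (period-⁻¹ pa x x∈X))

  module Automorphism (f : Sub → Sub) (aut : IsAutP₀ f) (pullback : TrivialPullback f) where

    private
      injective : ∀ X Y → Fin.zero ∈ X → Fin.zero ∈ Y → f X ≡ f Y → X ≡ Y
      injective = proj₁ (proj₂ aut)
      surjective : ∀ Y → Fin.zero ∈ Y → ∃ λ X → Fin.zero ∈ X × f X ≡ Y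
      surjective = proj₁ (proj₂ (proj₂ aut))
      homomorphic : ∀ X Y → Fin.zero ∈ X → Fin.zero ∈ Y → f (X ⊕ Y) ≡ f X ⊕ f Y
      homomorphic = proj₁ (proj₂ (proj₂ (proj₂ aut)))
      unital : f ⁅ Fin.zero ⁆ ≡ ⁅ Fin.zero ⁆
      unital = proj₂ (proj₂ (proj₂ (proj₂ aut)))

    fixes-pairSum : ∀ {X} → PairSum X → f X ≡ X
    fixes-pairSum ε        = unital
    fixes-pairSum (pair a) = pullback a
    fixes-pairSum (_⊕ₚ_ {X} {Y} p q) =
      trans (homomorphic X Y (0∈PairSum p) (0∈PairSum q)) (cong₂ _⊕_ (fixes-pairSum p) (fixes-pairSum q))

    fixes-scattered : ∀ {X c} → Fin.zero ∈ X → c ∉ X → Scattered X →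
                      (∀ a → ¬ Period X a → f (X ⊕ ⁅0, a ⁆) ≡ X ⊕ ⁅0, a ⁆) → f X ≡ X
    fixes-scattered {X} 0∈X c∉X scattered fixes-extensions
      with V , 0∈V , fV≡X ← surjective X 0∈X =
      trans (cong f (sym V≡X)) fV≡X
      where
      agree : ∀ a → ¬ Period X a → V ⊕ ⁅0, a ⁆ ≡ X ⊕ ⁅0, a ⁆
      agree a ¬pa = injective _ _ (0∈⊕ 0∈V (0∈⁅0,a⁆ a)) (0∈⊕ 0∈X (0∈⁅0,a⁆ a)) (begin
        f (V ⊕ ⁅0, a ⁆)     ≡⟨ homomorphic V ⁅0, a ⁆ 0∈V (0∈⁅0,a⁆ a) ⟩
        f V ⊕ f ⁅0, a ⁆     ≡⟨ cong₂ _⊕_ fV≡X (pullback a) ⟩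
        X ⊕ ⁅0, a ⁆         ≡⟨ fixes-extensions a ¬pa ⟨
        f (X ⊕ ⁅0, a ⁆)     ∎)
        where open ≡-Reasoning
      V≡X : V ≡ X
      V≡X = ⊕⁅0,a⁆-cancel c∉X scattered agree

    fixes-P₀ : ∀ X → Fin.zero ∈ X → f X ≡ X
    fixes-P₀ = All.wfRec ⊃-wellFounded _ (λ X → Fin.zero ∈ X → f X ≡ X) step
      where
      step : ∀ X → (∀ {Y} → Y ⊃ X → Fin.zero ∈ Y → f Y ≡ Y) → Fin.zero ∈ X → f X ≡ X
      step X fixes-supersets 0∈X with all? (_∈? X)
      ... | yes full = fixes-pairSum (full⇒pairSum full)
      ... | no ¬full with c , c∉X ← ¬∀⟶∃¬ (suc n) _ (_∈? X) ¬full
        with cosetComplement-or-scattered X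
      ...   | inj₁ coset     = fixes-pairSum (cosetComplement⇒pairSum 0∈X coset)
      ...   | inj₂ scattered = fixes-scattered 0∈X c∉X scattered λ a ¬pa →
        fixes-supersets (¬period⇒⊂ ¬pa) (0∈⊕ 0∈X (0∈⁅0,a⁆ a))

corollary3p4 : (n : ℕ) (f : Subset (suc n) → Subset (suc n)) →
    IsAutP₀ f → TrivialPullback f →
    (X : Subset (suc n)) → InP₀ X → f X ≡ X
corollary3p4 n f aut pullback = PowerMonoid.Automorphism.fixes-P₀ n f aut pullback
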